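{- For every integer $n\ge 6$, there exist at least two complete generalized Zeckendorf games on $n$ with different numbers of moves, one with an odd number of moves and one with an even number of moves (so that in a two-player game either player can win).
   Context: Let $a_1=1$, $a_2=2$ and $a_{i+1}=i\,a_i+a_{i-1}$ for $i\ge 2$. The generalized Zeckendorf game on $n$: the state is a multiset of terms of the sequence, initially $n$ copies of $a_1=1$. A move is one of: (combining) replace two $1$'s by one $2$; or, for $i\ge 2$, if the multiset contains at least $i$ copies of $a_i$ and at least one $a_{i-1}$, replace $i$ copies of $a_i$ and one $a_{i-1}$ by one $a_{i+1}$; (splitting) if it contains three $2$'s, replace them by one $1$ and one $5$; or, for $i\ge 3$, if it contains $i+1$ copies of $a_i$, replace them by one $a_{i+1}$, $i-2$ copies of $a_{i-1}$ and one $a_{i-2}$. Players alternate moves until no move is available; the player making the last move wins. A complete game is a sequence of legal moves from the initial state to a state with no available move. -}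

module Defs where

open import Data.Nat using (ℕ; zero; suc; _+_; _∸_; _≤_; _≡ᵇ_)
open import Data.Bool using (if_then_else_)
open import Data.Product using (Σ; _×_)
open import Relation.Nullary using (¬_)
open import Relation.Binary.PropositionalEquality using (_≡_)

-- The sequence a : a 1 = 1, a 2 = 2, a (i+1) = i * a i + a (i-1).
-- (a 0 is an unused dummy value.)  The sequence is strictly increasing
-- from index 1, so a multiset of terms of the sequence is the same as a
-- multiplicity function on indices i ≥ 1.
a : ℕ → ℕ
a 0 = 0
a 1 = 1
a 2 = 2
a (suc (suc (suc i))) = suc (suc i) * a (suc (suc i)) + a (suc i)
  where open Data.Nat using (_*_)

-- A state: state k = number of copies of a k in the multiset (index 0 unused).
State : Set
State = ℕ → ℕ

single : ℕ → ℕ → ℕ → ℕ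
single i c k = if k ≡ᵇ i then c else 0

initial : ℕ → State
initial n = single 1 n

data Move : Set where
  -- 1 + 1 -> 2
  combine1 : Move
  -- i copies of a_i and one a_(i-1) -> a_(i+1), for i ≥ 2
  combine  : (i : ℕ) → 2 ≤ i → Move
  -- three 2's -> 1 + 5  (i.e. a_1 + a_3)
  split2   : Move
  -- i+1 copies of a_i -> a_(i+1) + (i-2) copies of a_(i-1) + a_(i-2), for i ≥ 3
  split    : (i : ℕ) → 3 ≤ i → Move

removed : Move → ℕ → ℕ
removed combine1     k = single 1 2 k
removed (combine i _) k = single i i k + single (i ∸ 1) 1 k
removed split2       k = single 2 3 k
removed (split i _)  k = single i (suc i) k

added : Move → ℕ → ℕ
added combine1      k = single 2 1 k
added (combine i _) k = single (suc i) 1 k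
added split2        k = single 1 1 k + single 3 1 k
added (split i _)   k = single (suc i) 1 k + single (i ∸ 1) (i ∸ 2) k + single (i ∸ 2) 1 k

Legal : Move → State → Set
Legal m s = ∀ k → removed m k ≤ s k

Step : State → State → Set
Step s t = Σ Move λ m → Legal m s × (∀ k → t k + removed m k ≡ s k + added m k)

Terminal : State → Set
Terminal s = ¬ (Σ Move λ m → Legal m s)

data Play : State → ℕ → Set where
  done : ∀ {s} → Terminal s → Play s 0
  step : ∀ {s t k} → Step s t → Play t k → Play s (suc k)

CompleteGame : ℕ → ℕ → Set
CompleteGame n k = Play (initial n) k

{-# OPTIONS --safe #-}
module Submission where

-- From n ≥ 6 ones, the openings 1+1→2 (twice), 2+2+1→5 and 1+1→2 (three times), 2+2+2→1+5
-- reach the same state, in 3 and 4 moves. Every move lowers the number of pieces and raises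
-- the largest index in use by at most one, so every continuation from that state
-- terminates; appending one such complete play to both openings gives games of
-- consecutive lengths, hence of both parities.

open import Defs
open import Data.Nat using (ℕ; zero; suc; _+_; _∸_; _≤_; _<_; _%_; _≡ᵇ_; z≤n; s≤s; _≤?_)
open import Data.Nat.Properties
open import Data.Nat.Induction using (<-wellFounded)
open import Algebra.Properties.CommutativeSemigroup +-commutativeSemigroup using (interchange)
open import Data.Bool using (true; false)
open import Data.Product using (Σ; ∃; _×_; _,_; proj₁; proj₂)
open import Data.Sum using (_⊎_; inj₁; inj₂)
open import Function using (_∘_)
open import Function.Bundles using (_⇔_; mk⇔; Equivalence)
open import Induction.WellFounded using (Acc; acc)
open import Relation.Nullary using (Dec; yes; no; contradiction)
open import Relation.Nullary.Decidable using (_×-dec_; _⊎-dec_; map′)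
open import Relation.Binary.PropositionalEquality
  using (_≡_; _≢_; refl; sym; trans; cong; cong₂; subst; ≢-sym; module ≡-Reasoning)

≡ᵇ-refl : ∀ i → (i ≡ᵇ i) ≡ true
≡ᵇ-refl zero    = refl
≡ᵇ-refl (suc i) = ≡ᵇ-refl i

≢⇒≡ᵇ-false : ∀ k i → k ≢ i → (k ≡ᵇ i) ≡ false
≢⇒≡ᵇ-false zero    zero    k≢i = contradiction refl k≢i
≢⇒≡ᵇ-false zero    (suc i) _   = refl
≢⇒≡ᵇ-false (suc k) zero    _   = refl
≢⇒≡ᵇ-false (suc k) (suc i) k≢i = ≢⇒≡ᵇ-false k i (k≢i ∘ cong suc)

single-self : ∀ i c → single i c i ≡ c
single-self i c rewrite ≡ᵇ-refl i = refl

single-other : ∀ {i k} c → k ≢ i → single i c k ≡ 0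
single-other {i} {k} c k≢i rewrite ≢⇒≡ᵇ-false k i k≢i = refl

single-beyond : ∀ {i k} c → i < k → single i c k ≡ 0
single-beyond c i<k = single-other c (>⇒≢ i<k)

single-≤⇔ : ∀ {s : State} {i c} → (∀ k → single i c k ≤ s k) ⇔ c ≤ s i
single-≤⇔ {s} {i} {c} = mk⇔ (λ le → subst (_≤ s i) (single-self i c) (le i)) fits
  where
  fits : c ≤ s i → ∀ k → single i c k ≤ s k
  fits c≤si k with k ≟ i
  ... | yes refl = subst (_≤ s i) (sym (single-self i c)) c≤si
  ... | no k≢i   = subst (_≤ s k) (sym (single-other c k≢i)) z≤n

single₂-≤⇔ : ∀ {s : State} {i j c d} → i ≢ j →
  (∀ k → single i c k + single j d k ≤ s k) ⇔ (c ≤ s i × d ≤ s j)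
single₂-≤⇔ {s} {i} {j} {c} {d} i≢j = mk⇔ parts fits
  where
  parts : (∀ k → single i c k + single j d k ≤ s k) → c ≤ s i × d ≤ s j
  parts le =
    subst (_≤ s i) (trans (cong₂ _+_ (single-self i c) (single-other d i≢j)) (+-identityʳ c)) (le i) ,
    subst (_≤ s j) (cong₂ _+_ (single-other c (≢-sym i≢j)) (single-self j d)) (le j)
  fits : c ≤ s i × d ≤ s j → ∀ k → single i c k + single j d k ≤ s k
  fits (c≤si , d≤sj) k with k ≟ i | k ≟ j
  ... | yes refl | _ rewrite single-self i c | single-other d i≢j | +-identityʳ c = c≤si
  ... | no k≢i | yes refl rewrite single-other c k≢i | single-self j d = d≤sj
  ... | no k≢i | no k≢j rewrite single-other c k≢i | single-other d k≢j = z≤n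

SupportBelow : ℕ → State → Set
SupportBelow N s = ∀ k → N ≤ k → s k ≡ 0

occupied⇒below : ∀ {N s i} → SupportBelow N s → 1 ≤ s i → i < N
occupied⇒below {N} {s} {i} supp 1≤si with N ≤? i
... | yes N≤i = contradiction (subst (1 ≤_) (supp i N≤i) 1≤si) λ ()
... | no N≰i  = ≰⇒> N≰i

initial-supportBelow : ∀ n → SupportBelow 2 (initial n)
initial-supportBelow n k 2≤k = single-beyond n 2≤k

source : Move → ℕ
source combine1      = 1
source (combine i _) = i
source split2        = 2
source (split i _)   = i

i≢i∸1 : ∀ {i} → 1 ≤ i → i ≢ i ∸ 1
i≢i∸1 {suc i} _ = >⇒≢ (n<1+n i)

legal-combine⇔ : ∀ {s i} (p : 2 ≤ i) → Legal (combine i p) s ⇔ (i ≤ s i × 1 ≤ s (i ∸ 1))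
legal-combine⇔ p = single₂-≤⇔ (i≢i∸1 (≤-trans (s≤s z≤n) p))

legal⇒source-occupied : ∀ m {s} → Legal m s → 1 ≤ s (source m)
legal⇒source-occupied combine1      L = ≤-trans (s≤s z≤n) (Equivalence.to single-≤⇔ L)
legal⇒source-occupied (combine i p) L =
  ≤-trans (≤-trans (s≤s z≤n) p) (proj₁ (Equivalence.to (legal-combine⇔ p) L))
legal⇒source-occupied split2        L = ≤-trans (s≤s z≤n) (Equivalence.to single-≤⇔ L)
legal⇒source-occupied (split i _)   L = ≤-trans (s≤s z≤n) (Equivalence.to single-≤⇔ L)

legal⇒source< : ∀ {N s} m → SupportBelow N s → Legal m s → source m < N
legal⇒source< m supp L = occupied⇒below supp (legal⇒source-occupied m L)

MoveAvailable : State → Set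
MoveAvailable s = Σ Move λ m → Legal m s

CombinableAt : State → ℕ → Set
CombinableAt s i = 2 ≤ i × i ≤ s i × 1 ≤ s (i ∸ 1)

SplittableAt : State → ℕ → Set
SplittableAt s i = 3 ≤ i × suc i ≤ s i

-- A finite, decidable substitute for the existence of a legal move, valid for states supported below N.
AvailabilityCriterion : ℕ → State → Set
AvailabilityCriterion N s =
  2 ≤ s 1 ⊎ 3 ≤ s 2 ⊎ (∃ λ i → i < N × CombinableAt s i) ⊎ (∃ λ i → i < N × SplittableAt s i)

criterion⇒available : ∀ {N s} → AvailabilityCriterion N s → MoveAvailable s
criterion⇒available (inj₁ 2≤s₁) = combine1 , Equivalence.from single-≤⇔ 2≤s₁
criterion⇒available (inj₂ (inj₁ 3≤s₂)) = split2 , Equivalence.from single-≤⇔ 3≤s₂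
criterion⇒available (inj₂ (inj₂ (inj₁ (i , _ , p , enough)))) =
  combine i p , Equivalence.from (legal-combine⇔ p) enough
criterion⇒available (inj₂ (inj₂ (inj₂ (i , _ , p , enough)))) =
  split i p , Equivalence.from single-≤⇔ enough

available⇒criterion : ∀ {N s} → SupportBelow N s → MoveAvailable s → AvailabilityCriterion N s
available⇒criterion supp (combine1 , L) = inj₁ (Equivalence.to single-≤⇔ L)
available⇒criterion supp (split2 , L)   = inj₂ (inj₁ (Equivalence.to single-≤⇔ L))
available⇒criterion supp (m@(combine i p) , L) =
  inj₂ (inj₂ (inj₁ (i , legal⇒source< m supp L , p , Equivalence.to (legal-combine⇔ p) L)))
available⇒criterion supp (m@(split i p) , L) =
  inj₂ (inj₂ (inj₂ (i , legal⇒source< m supp L , p , Equivalence.to single-≤⇔ L)))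

moveAvailable? : ∀ {N s} → SupportBelow N s → Dec (MoveAvailable s)
moveAvailable? {N} {s} supp =
  map′ criterion⇒available (available⇒criterion supp)
    (2 ≤? s 1 ⊎-dec 3 ≤? s 2 ⊎-dec anyUpTo? combinable? N ⊎-dec anyUpTo? splittable? N)
  where
  combinable? : ∀ i → Dec (CombinableAt s i)
  combinable? i = 2 ≤? i ×-dec i ≤? s i ×-dec 1 ≤? s (i ∸ 1)
  splittable? : ∀ i → Dec (SplittableAt s i)
  splittable? i = 3 ≤? i ×-dec suc i ≤? s i

pieces : ℕ → State → ℕ
pieces zero    s = 0
pieces (suc N) s = pieces N s + s N

pieces-cong : ∀ N {f g : State} → (∀ k → f k ≡ g k) → pieces N f ≡ pieces N g
pieces-cong zero    f≗g = refl
pieces-cong (suc N) f≗g = cong₂ _+_ (pieces-cong N f≗g) (f≗g N)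

pieces-+ : ∀ N (f g : State) → pieces N (λ k → f k + g k) ≡ pieces N f + pieces N g
pieces-+ zero    f g = refl
pieces-+ (suc N) f g =
  trans (cong (_+ (f N + g N)) (pieces-+ N f g)) (interchange (pieces N f) (pieces N g) (f N) (g N))

pieces-single-beyond : ∀ N {i} c → N ≤ i → pieces N (single i c) ≡ 0
pieces-single-beyond zero    c _     = refl
pieces-single-beyond (suc N) c 1+N≤i =
  cong₂ _+_ (pieces-single-beyond N c (≤-trans (n≤1+n N) 1+N≤i)) (single-other c (<⇒≢ 1+N≤i))

pieces-single : ∀ {N i} c → i < N → pieces N (single i c) ≡ c
pieces-single {suc N} {i} c (s≤s i≤N) with m≤n⇒m<n∨m≡n i≤N
... | inj₁ i<N  = trans (cong₂ _+_ (pieces-single c i<N) (single-beyond c i<N)) (+-identityʳ c)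
... | inj₂ refl = cong₂ _+_ (pieces-single-beyond i c ≤-refl) (single-self i c)

pieces-supportBelow : ∀ {N s} → SupportBelow N s → pieces (suc N) s ≡ pieces N s
pieces-supportBelow {N} {s} supp = trans (cong (pieces N s +_) (supp N ≤-refl)) (+-identityʳ (pieces N s))

consumed : Move → ℕ
consumed combine1      = 2
consumed (combine i _) = suc i
consumed split2        = 3
consumed (split i _)   = suc i

produced : Move → ℕ
produced combine1      = 1
produced (combine _ _) = 1
produced split2        = 2
produced (split i _)   = i

produced<consumed : ∀ m → produced m < consumed m
produced<consumed combine1             = ≤-refl
produced<consumed (combine (suc i) _) = s≤s (s≤s z≤n)
produced<consumed split2               = ≤-refl
produced<consumed (split i _)          = ≤-refl

pieces-removed : ∀ m {N} → source m < N → pieces N (removed m) ≡ consumed m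
pieces-removed combine1      1<N = pieces-single 2 1<N
pieces-removed (combine i _) {N} i<N =
  trans (pieces-+ N (single i i) (single (i ∸ 1) 1))
        (trans (cong₂ _+_ (pieces-single i i<N) (pieces-single 1 (≤-<-trans (m∸n≤m i 1) i<N)))
               (+-comm i 1))
pieces-removed split2        2<N = pieces-single 3 2<N
pieces-removed (split i _)   i<N = pieces-single (suc i) i<N

pieces-added : ∀ m {N} → suc (source m) < N → pieces N (added m) ≡ produced m
pieces-added combine1      2<N = pieces-single 1 2<N
pieces-added (combine i _) 1+i<N = pieces-single 1 1+i<N
pieces-added split2        {N} 3<N =
  trans (pieces-+ N (single 1 1) (single 3 1))
        (cong₂ _+_ (pieces-single 1 (≤-trans (s≤s (s≤s z≤n)) 3<N)) (pieces-single 1 3<N))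
pieces-added (split i 3≤i) {N} 1+i<N = begin
  pieces N (λ k → single (suc i) 1 k + single (i ∸ 1) (i ∸ 2) k + single (i ∸ 2) 1 k)
    ≡⟨ pieces-+ N (λ k → single (suc i) 1 k + single (i ∸ 1) (i ∸ 2) k) (single (i ∸ 2) 1) ⟩
  pieces N (λ k → single (suc i) 1 k + single (i ∸ 1) (i ∸ 2) k) + pieces N (single (i ∸ 2) 1)
    ≡⟨ cong (_+ pieces N (single (i ∸ 2) 1)) (pieces-+ N (single (suc i) 1) (single (i ∸ 1) (i ∸ 2))) ⟩
  pieces N (single (suc i) 1) + pieces N (single (i ∸ 1) (i ∸ 2)) + pieces N (single (i ∸ 2) 1)
    ≡⟨ cong₂ _+_ (cong₂ _+_ (pieces-single 1 1+i<N) (pieces-single (i ∸ 2) (below 1)))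
                 (pieces-single 1 (below 2)) ⟩
  1 + (i ∸ 2) + 1
    ≡⟨ cong suc (+-comm (i ∸ 2) 1) ⟩
  2 + (i ∸ 2)
    ≡⟨ m+[n∸m]≡n (≤-trans (n≤1+n 2) 3≤i) ⟩
  i ∎
  where
  open ≡-Reasoning
  below : ∀ d → i ∸ d < N
  below d = <-trans (s≤s (m∸n≤m i d)) 1+i<N

added-supportBelow : ∀ m → SupportBelow (2 + source m) (added m)
added-supportBelow combine1      k 3≤k   = single-beyond 1 3≤k
added-supportBelow (combine i _) k 2+i≤k = single-beyond 1 2+i≤k
added-supportBelow split2        k 4≤k   =
  cong₂ _+_ (single-beyond 1 (≤-trans (s≤s (s≤s z≤n)) 4≤k)) (single-beyond 1 4≤k)
added-supportBelow (split i _)   k 2+i≤k =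
  cong₂ _+_ (cong₂ _+_ (single-beyond 1 2+i≤k) (single-beyond (i ∸ 2) (below 1)))
            (single-beyond 1 (below 2))
  where
  below : ∀ d → i ∸ d < k
  below d = <-trans (s≤s (m∸n≤m i d)) 2+i≤k

move : Move → State → State
move m s k = s k + added m k ∸ removed m k

move-step : ∀ {s} m → Legal m s → Step s (move m s)
move-step {s} m L = m , L , λ k → m∸n+n≡m (≤-trans (L k) (m≤m+n (s k) (added m k)))

move-supportBelow : ∀ {N s} m → SupportBelow N s → Legal m s → SupportBelow (suc N) (move m s)
move-supportBelow {N} {s} m supp L k 1+N≤k =
  trans (cong₂ (λ x y → x + y ∸ removed m k) (supp k (≤-trans (n≤1+n N) 1+N≤k)) added-vanishes)
        (0∸n≡0 (removed m k))
  where
  added-vanishes : added m k ≡ 0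
  added-vanishes = added-supportBelow m k (≤-trans (s≤s (legal⇒source< m supp L)) 1+N≤k)

balance⇒< : ∀ {x y c p} → x + c ≡ y + p → p < c → x < y
balance⇒< {x} {y} x+c≡y+p p<c with y ≤? x
... | yes y≤x = contradiction (sym x+c≡y+p) (<⇒≢ (+-mono-≤-< y≤x p<c))
... | no y≰x  = ≰⇒> y≰x

move-pieces< : ∀ {N s} m → SupportBelow N s → Legal m s → pieces (suc N) (move m s) < pieces N s
move-pieces< {N} {s} m supp L = balance⇒< balance (produced<consumed m)
  where
  open ≡-Reasoning
  source<N = legal⇒source< m supp L
  balance : pieces (suc N) (move m s) + consumed m ≡ pieces N s + produced m
  balance = begin
    pieces (suc N) (move m s) + consumed m
      ≡⟨ cong (pieces (suc N) (move m s) +_) (pieces-removed m (≤-trans source<N (n≤1+n N))) ⟨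
    pieces (suc N) (move m s) + pieces (suc N) (removed m)
      ≡⟨ pieces-+ (suc N) (move m s) (removed m) ⟨
    pieces (suc N) (λ k → move m s k + removed m k)
      ≡⟨ pieces-cong (suc N) (proj₂ (proj₂ (move-step m L))) ⟩
    pieces (suc N) (λ k → s k + added m k)
      ≡⟨ pieces-+ (suc N) s (added m) ⟩
    pieces (suc N) s + pieces (suc N) (added m)
      ≡⟨ cong₂ _+_ (pieces-supportBelow supp) (pieces-added m (s≤s source<N)) ⟩
    pieces N s + produced m ∎

complete-play : ∀ {N s} → SupportBelow N s → Acc _<_ (pieces N s) → ∃ (Play s)
complete-play supp (acc smaller) with moveAvailable? supp
... | no stuck     = 0 , done stuck
... | yes (m , L) =
  Data.Product.map suc (step (move-step m L))
    (complete-play (move-supportBelow m supp L) (smaller (move-pieces< m supp L)))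

step-respʳ : ∀ {s t t′} → Step s t → (∀ k → t k ≡ t′ k) → Step s t′
step-respʳ (m , L , balance) t≗t′ = m , L , λ k → trans (cong (_+ removed m k) (sym (t≗t′ k))) (balance k)

combine₂ : Move
combine₂ = combine 2 (s≤s (s≤s z≤n))

module Openings (m : ℕ) where

  S₀ S₁ S₂ S₃ T : State
  S₀ = initial (6 + m)
  S₁ = move combine1 S₀
  S₂ = move combine1 S₁
  S₃ = move combine1 S₂
  T  = move combine₂ S₂

  legal₀ : Legal combine1 S₀
  legal₀ = Equivalence.from single-≤⇔ (s≤s (s≤s z≤n))

  legal₁ : Legal combine1 S₁
  legal₁ = Equivalence.from single-≤⇔ (s≤s (s≤s z≤n))

  legal₂ : Legal combine₂ S₂
  legal₂ = Equivalence.from (legal-combine⇔ (s≤s (s≤s z≤n))) (≤-refl , s≤s z≤n)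

  legal₂′ : Legal combine1 S₂
  legal₂′ = Equivalence.from single-≤⇔ (s≤s (s≤s z≤n))

  legal₃ : Legal split2 S₃
  legal₃ = Equivalence.from single-≤⇔ ≤-refl

  split2-reaches-T : ∀ k → move split2 S₃ k ≡ T k
  split2-reaches-T 0 = refl
  split2-reaches-T 1 = +-comm (m + 0 + 0 + 0) 1
  split2-reaches-T 2 = refl
  split2-reaches-T 3 = refl
  split2-reaches-T (suc (suc (suc (suc k)))) = refl

  T-supportBelow : SupportBelow 5 T
  T-supportBelow =
    move-supportBelow combine₂
      (move-supportBelow combine1 (move-supportBelow combine1 (initial-supportBelow (6 + m)) legal₀) legal₁)
      legal₂

  tail : ∃ (Play T)
  tail = complete-play T-supportBelow (<-wellFounded (pieces 5 T))

  short : CompleteGame (6 + m) (3 + proj₁ tail)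
  short = step (move-step combine1 legal₀) (step (move-step combine1 legal₁)
            (step (move-step combine₂ legal₂) (proj₂ tail)))

  long : CompleteGame (6 + m) (4 + proj₁ tail)
  long = step (move-step combine1 legal₀) (step (move-step combine1 legal₁)
           (step (move-step combine1 legal₂′)
             (step (step-respʳ (move-step split2 legal₃) split2-reaches-T) (proj₂ tail))))

consecutive-complete-games : ∀ m → Σ ℕ λ k → CompleteGame (6 + m) k × CompleteGame (6 + m) (suc k)
consecutive-complete-games m = 3 + proj₁ tail , short , long
  where open Openings m

consecutive-parities : ∀ k → (k % 2 ≡ 1 × suc k % 2 ≡ 0) ⊎ (k % 2 ≡ 0 × suc k % 2 ≡ 1)
consecutive-parities zero          = inj₂ (refl , refl)
consecutive-parities (suc zero)    = inj₁ (refl , refl)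
consecutive-parities (suc (suc k)) = consecutive-parities k

HasGamesOfBothParities : ℕ → Set
HasGamesOfBothParities n =
  Σ ℕ λ k₁ → Σ ℕ λ k₂ → CompleteGame n k₁ × CompleteGame n k₂ × k₁ % 2 ≡ 1 × k₂ % 2 ≡ 0

consecutive⇒both-parities : ∀ {n k} → CompleteGame n k → CompleteGame n (suc k) → HasGamesOfBothParities n
consecutive⇒both-parities {k = k} g g′ with consecutive-parities k
... | inj₁ (odd , even) = k , suc k , g , g′ , odd , even
... | inj₂ (even , odd) = suc k , k , g′ , g , odd , even

theorem6p3 : (n : ℕ) → 6 ≤ n →
    Σ ℕ λ k₁ → Σ ℕ λ k₂ →
      CompleteGame n k₁ × CompleteGame n k₂ × k₁ % 2 ≡ 1 × k₂ % 2 ≡ 0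
theorem6p3 n 6≤n with consecutive-complete-games (n ∸ 6)
... | _ , g , g′ = subst HasGamesOfBothParities (m+[n∸m]≡n 6≤n) (consecutive⇒both-parities g g′)
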